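{- The parameters $ChVD$ and $ChVS$ are not equivalent: there is no function $f$ such that $ChVS(G)\le f(ChVD(G))$ for every graph $G$.
   Context: All graphs are finite, simple and undirected. A (vertex) split of a vertex $v$ of a graph $G$ chooses sets $A,B\subseteq N_G(v)$ with $A\cup B=N_G(v)$ and replaces $v$ by two new vertices $v_1,v_2$, where $v_1$ is adjacent exactly to $A$ and $v_2$ exactly to $B$ (all other adjacencies unchanged). A chordal graph is a graph with no induced cycle of length at least $4$. $ChVS(G)$ is the minimum length of a sequence of splits turning $G$ into a chordal graph, and $ChVD(G)$ is the minimum number of vertex deletions turning $G$ into a chordal graph. -}

module Defs where

open import Data.Nat using (ℕ; zero; suc; _≤_; _+_)
open import Data.Nat.DivMod using (_%_)
open import Data.Fin using (Fin; zero; suc; toℕ)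
open import Data.Fin.Subset using (Subset; _∉_; ∣_∣)
open import Data.Bool using (Bool; true; false; _∨_; if_then_else_)
open import Data.Maybe using (Maybe; just; nothing)
open import Data.Product using (Σ; ∃; _×_; _,_)
open import Data.Sum using (_⊎_)
open import Data.Empty using (⊥)
open import Relation.Nullary using (¬_; does)
open import Relation.Binary.PropositionalEquality using (_≡_)
open import Function.Definitions using (Injective)
open import Function.Bundles using (_⇔_)
import Data.Fin as F
import Data.Maybe as M

Adj : ℕ → Set
Adj n = Fin n → Fin n → Bool

record IsGraph {n : ℕ} (G : Adj n) : Set where
  field
    symmetric  : ∀ x y → G x y ≡ G y x
    irreflexive : ∀ x → G x x ≡ false

CycAdj : (m : ℕ) → Fin (4 + m) → Fin (4 + m) → Set
CycAdj m i j = (suc (toℕ i) % (4 + m) ≡ toℕ j) ⊎ (suc (toℕ j) % (4 + m) ≡ toℕ i)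

record InducedCycleIn {n : ℕ} (G : Adj n) (keep : Fin n → Set) (m : ℕ) : Set where
  field
    vtx       : Fin (4 + m) → Fin n
    injective : Injective _≡_ _≡_ vtx
    inKeep    : ∀ i → keep (vtx i)
    induced   : ∀ i j → (G (vtx i) (vtx j) ≡ true) ⇔ CycAdj m i j

ChordalOn : {n : ℕ} → Adj n → (Fin n → Set) → Set
ChordalOn G keep = ∀ m → ¬ InducedCycleIn G keep m

Chordal : {n : ℕ} → Adj n → Set
Chordal {n} G = ChordalOn G (λ _ → Fin n)

ChordalDeletion : {n : ℕ} → Adj n → Subset n → Set
ChordalDeletion G D = ChordalOn G (λ x → x ∉ D)

IsChVD : {n : ℕ} → Adj n → ℕ → Set
IsChVD {n} G k =
  Σ (Subset n) (λ D → ChordalDeletion G D × ∣ D ∣ ≡ k)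
  × (∀ (D : Subset n) → ChordalDeletion G D → k ≤ ∣ D ∣)

-- Fin (suc n) viewed as the old vertices (just i) plus one new vertex
-- (nothing), the new vertex being the last one.
view : {n : ℕ} → Fin (suc n) → Maybe (Fin n)
view {zero}  zero    = nothing
view {suc n} zero    = just zero
view {suc n} (suc i) = M.map suc (view i)

IsSplitData : {n : ℕ} → Adj n → Fin n → (Fin n → Bool) → (Fin n → Bool) → Set
IsSplitData G v A B = ∀ u → (A u ∨ B u) ≡ G v u

-- The graph obtained by splitting v: v itself becomes v₁ (adjacent exactly
-- to A), the new last vertex is v₂ (adjacent exactly to B).
split : {n : ℕ} → Adj n → Fin n → (Fin n → Bool) → (Fin n → Bool) → Adj (suc n)
split G v A B x y with view x | view y
... | nothing | nothing = false
... | nothing | just y' = B y'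
... | just x' | nothing = B x'
... | just x' | just y' =
  if does (x' F.≟ v) then A y'
  else (if does (y' F.≟ v) then A x' else G x' y')

data SplitSeq : {n m : ℕ} → Adj n → Adj m → ℕ → Set where
  done : {n : ℕ} {G : Adj n} → SplitSeq G G 0
  step : {n m : ℕ} {G : Adj n} {H : Adj m} {k : ℕ}
         (v : Fin n) (A B : Fin n → Bool) → IsSplitData G v A B →
         SplitSeq (split G v A B) H k → SplitSeq G H (suc k)

ChVS≤ : {n : ℕ} → Adj n → ℕ → Set
ChVS≤ G s = Σ ℕ λ m → Σ (Adj m) λ H → Σ ℕ λ k →
  SplitSeq G H k × Chordal H × k ≤ s

{-# OPTIONS --safe #-}
module Submission where

open import Defs
open import Data.Nat using (ℕ; zero; suc; _+_; _*_; _^_; _≤_; _<_; z≤n; s≤s; _≤?_)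
open import Data.Nat.Properties
  using (≤-trans; <-≤-trans; ≤-reflexive; ≰⇒>; <-irrefl; +-mono-<; +-suc; +-identityʳ; m≤m+n; m≤n+m;
         *-assoc; *-identityˡ; *-monoˡ-≤; ^-monoʳ-≤; n≮0; n≢0⇒n>0)
open import Data.Fin using (Fin; zero; suc; inject₁; fromℕ; _↑ʳ_; _≟_)
open import Data.Fin.Properties using (inject₁-injective; fromℕ≢inject₁; ↑ʳ-injective)
open import Data.Fin.Subset using (Subset; _∉_; ∣_∣; ⁅_⁆; _-_)
open import Data.Fin.Subset.Properties using (x∈⁅x⁆; ∣⁅x⁆∣≡1; x∈p⇒∣p-x∣<∣p∣)
open import Data.Bool as Bool using (Bool; true; false; _∨_; _xor_)
open import Data.Bool.Properties using (xor-comm; xor-same; ∨-conicalˡ; ∨-conicalʳ; ¬-not)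
open import Data.Maybe using (just; nothing)
open import Data.Product using (_×_; _,_; proj₁; swap)
open import Data.Sum using (_⊎_; inj₁; inj₂; [_,_]′)
open import Data.Empty using (⊥)
open import Data.List using (List; []; _∷_; length; map; filter; tabulate)
open import Data.List.Properties using (length-map; length-tabulate; filter-all)
open import Data.List.Relation.Unary.All as All using (All; []; _∷_)
import Data.List.Relation.Unary.All.Properties as All
open import Data.List.Relation.Unary.AllPairs using (AllPairs; []; _∷_)
import Data.List.Relation.Unary.AllPairs.Properties as AllPairs
open import Data.List.Relation.Unary.Unique.Propositional using (Unique)
import Data.List.Relation.Unary.Unique.Propositional.Properties as Unique
open import Relation.Nullary using (¬_; yes; no; does; contradiction)
open import Relation.Nullary.Decidable using (dec-true; dec-false)
open import Relation.Unary using (Pred; Decidable)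
open import Relation.Unary.Properties using (∁?)
open import Relation.Binary.Definitions using (DecidableEquality)
open import Relation.Binary.PropositionalEquality
open import Function using (_∘_; const)
open import Function.Bundles using (_⇔_; mk⇔; Equivalence)
open import Function.Definitions using (Injective)
open import Level using (0ℓ)

-- Deleting one hub of K_{2,s} leaves a star, so ChVD(K_{2,s}) = 1. On the other hand a split
-- cannot destroy much of an induced K_{2,t}: splitting a hub shares its leaves between the two
-- copies, one of which still sees at least half of them, and splitting any other vertex loses at
-- most that vertex as a leaf. So k splits of K_{2,s} with 2^(k+1) ≤ s leave an induced K_{2,2},
-- that is, an induced 4-cycle.

2*c≤m+n⇒c≤m⊎c≤n : ∀ c m n → 2 * c ≤ m + n → c ≤ m ⊎ c ≤ n
2*c≤m+n⇒c≤m⊎c≤n c m n 2c≤m+n with c ≤? m | c ≤? n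
... | yes c≤m | _       = inj₁ c≤m
... | no _    | yes c≤n = inj₂ c≤n
... | no c≰m  | no c≰n  = contradiction m+n<m+n (<-irrefl refl)
  where
  m+n<m+n : m + n < m + n
  m+n<m+n = <-≤-trans (+-mono-< (≰⇒> c≰m) (≰⇒> c≰n))
                      (subst (_≤ m + n) (cong (c +_) (+-identityʳ c)) 2c≤m+n)

2*c≤1+m⇒c≤m : ∀ c {m} → 2 * c ≤ suc m → c ≤ m
2*c≤1+m⇒c≤m zero    _             = z≤n
2*c≤1+m⇒c≤m (suc c) (s≤s 2c+1≤m) =
  ≤-trans (s≤s (m≤m+n c (c + 0))) (≤-trans (≤-reflexive (sym (+-suc c (c + 0)))) 2c+1≤m)

module _ {A : Set} {P : Pred A 0ℓ} (P? : Decidable P) where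

  length-filter-∁ : ∀ xs → length (filter P? xs) + length (filter (∁? P?) xs) ≡ length xs
  length-filter-∁ []       = refl
  length-filter-∁ (x ∷ xs) with does (P? x)
  ... | true  = cong suc (length-filter-∁ xs)
  ... | false = trans (+-suc _ _) (cong suc (length-filter-∁ xs))

module _ {A : Set} (_≟ᴬ_ : DecidableEquality A) where

  length≤1+length-filter-≢ : ∀ v {xs} → Unique xs →
                             length xs ≤ suc (length (filter (∁? (_≟ᴬ v)) xs))
  length≤1+length-filter-≢ v {[]}     _                = z≤n
  length≤1+length-filter-≢ v {x ∷ xs} (x∉xs ∷ xs-uniq) with x ≟ᴬ v
  ... | no _     = s≤s (length≤1+length-filter-≢ v xs-uniq)
  ... | yes refl =
    s≤s (≤-reflexive (cong length (sym (filter-all (∁? (_≟ᴬ x)) (All.map ≢-sym x∉xs)))))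

adjacent⇒≢ : ∀ {n} {G : Adj n} → IsGraph G → ∀ {x y} → G x y ≡ true → x ≢ y
adjacent⇒≢ graph {x} x~y refl = contradiction (trans (sym (IsGraph.irreflexive graph x)) x~y) λ ()

module _ {n} {G : Adj n} (graph : IsGraph G) {a b x y : Fin n}
         (a≢b : a ≢ b) (x≢y : x ≢ y) (a≁b : G a b ≡ false) (x≁y : G x y ≡ false)
         (a~x : G a x ≡ true) (b~x : G b x ≡ true) (a~y : G a y ≡ true) (b~y : G b y ≡ true)
         where

  private
    open IsGraph graph

    pattern c₀ = zero
    pattern c₁ = suc zero
    pattern c₂ = suc (suc zero)
    pattern c₃ = suc (suc (suc zero))

    square : Fin 4 → Fin n
    square c₀ = a
    square c₁ = x
    square c₂ = b
    square c₃ = y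

    swapped : ∀ {u w β} → G u w ≡ β → G w u ≡ β
    swapped = trans (symmetric _ _)

    square-injective : Injective _≡_ _≡_ square
    square-injective {c₀} {c₀} _ = refl
    square-injective {c₁} {c₁} _ = refl
    square-injective {c₂} {c₂} _ = refl
    square-injective {c₃} {c₃} _ = refl
    square-injective {c₀} {c₂} a≡b = contradiction a≡b a≢b
    square-injective {c₂} {c₀} b≡a = contradiction (sym b≡a) a≢b
    square-injective {c₁} {c₃} x≡y = contradiction x≡y x≢y
    square-injective {c₃} {c₁} y≡x = contradiction (sym y≡x) x≢y
    square-injective {c₀} {c₁} a≡x = contradiction a≡x (adjacent⇒≢ graph a~x)
    square-injective {c₁} {c₀} x≡a = contradiction (sym x≡a) (adjacent⇒≢ graph a~x)
    square-injective {c₀} {c₃} a≡y = contradiction a≡y (adjacent⇒≢ graph a~y)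
    square-injective {c₃} {c₀} y≡a = contradiction (sym y≡a) (adjacent⇒≢ graph a~y)
    square-injective {c₂} {c₁} b≡x = contradiction b≡x (adjacent⇒≢ graph b~x)
    square-injective {c₁} {c₂} x≡b = contradiction (sym x≡b) (adjacent⇒≢ graph b~x)
    square-injective {c₂} {c₃} b≡y = contradiction b≡y (adjacent⇒≢ graph b~y)
    square-injective {c₃} {c₂} y≡b = contradiction (sym y≡b) (adjacent⇒≢ graph b~y)

    edge : ∀ {i j} → G (square i) (square j) ≡ true → CycAdj 0 i j →
           (G (square i) (square j) ≡ true) ⇔ CycAdj 0 i j
    edge i~j adj = mk⇔ (const adj) (const i~j)

    nonEdge : ∀ {i j} → G (square i) (square j) ≡ false → ¬ CycAdj 0 i j →
              (G (square i) (square j) ≡ true) ⇔ CycAdj 0 i j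
    nonEdge i≁j ¬adj =
      mk⇔ (λ i~j → contradiction (trans (sym i≁j) i~j) λ ()) (λ adj → contradiction adj ¬adj)

    square-induced : ∀ i j → (G (square i) (square j) ≡ true) ⇔ CycAdj 0 i j
    square-induced c₀ c₀ = nonEdge (irreflexive a) λ { (inj₁ ()) ; (inj₂ ()) }
    square-induced c₀ c₁ = edge a~x (inj₁ refl)
    square-induced c₀ c₂ = nonEdge a≁b λ { (inj₁ ()) ; (inj₂ ()) }
    square-induced c₀ c₃ = edge a~y (inj₂ refl)
    square-induced c₁ c₀ = edge (swapped a~x) (inj₂ refl)
    square-induced c₁ c₁ = nonEdge (irreflexive x) λ { (inj₁ ()) ; (inj₂ ()) }
    square-induced c₁ c₂ = edge (swapped b~x) (inj₁ refl)
    square-induced c₁ c₃ = nonEdge x≁y λ { (inj₁ ()) ; (inj₂ ()) }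
    square-induced c₂ c₀ = nonEdge (swapped a≁b) λ { (inj₁ ()) ; (inj₂ ()) }
    square-induced c₂ c₁ = edge b~x (inj₂ refl)
    square-induced c₂ c₂ = nonEdge (irreflexive b) λ { (inj₁ ()) ; (inj₂ ()) }
    square-induced c₂ c₃ = edge b~y (inj₁ refl)
    square-induced c₃ c₀ = edge (swapped a~y) (inj₁ refl)
    square-induced c₃ c₁ = nonEdge (swapped x≁y) λ { (inj₁ ()) ; (inj₂ ()) }
    square-induced c₃ c₂ = edge (swapped b~y) (inj₂ refl)
    square-induced c₃ c₃ = nonEdge (irreflexive y) λ { (inj₁ ()) ; (inj₂ ()) }

  commonNeighbours⇒InducedCycle : {keep : Fin n → Set} → keep a → keep x → keep b → keep y →
                                  InducedCycleIn G keep 0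
  commonNeighbours⇒InducedCycle {keep} ka kx kb ky = record
    { vtx = square ; injective = square-injective ; inKeep = inKeep ; induced = square-induced }
    where
    inKeep : ∀ i → keep (square i)
    inKeep c₀ = ka
    inKeep c₁ = kx
    inKeep c₂ = kb
    inKeep c₃ = ky

centred⇒ChordalOn : ∀ {n} {G : Adj n} {keep : Fin n → Set} (c : Fin n) →
                    (∀ {x y} → keep x → keep y → G x y ≡ true → x ≡ c ⊎ y ≡ c) → ChordalOn G keep
centred⇒ChordalOn c centred m cycle =
  disjoint-edges (covers zero (suc zero) (inj₁ refl))
                 (covers (suc (suc zero)) (suc (suc (suc zero))) (inj₁ refl))
  where
  open InducedCycleIn cycle

  covers : ∀ i j → CycAdj m i j → vtx i ≡ c ⊎ vtx j ≡ c
  covers i j adj = centred (inKeep i) (inKeep j) (Equivalence.from (induced i j) adj)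

  disjoint-edges : vtx zero ≡ c ⊎ vtx (suc zero) ≡ c →
                   vtx (suc (suc zero)) ≡ c ⊎ vtx (suc (suc (suc zero))) ≡ c → ⊥
  disjoint-edges (inj₁ p) (inj₁ q) = contradiction (injective (trans p (sym q))) λ ()
  disjoint-edges (inj₁ p) (inj₂ q) = contradiction (injective (trans p (sym q))) λ ()
  disjoint-edges (inj₂ p) (inj₁ q) = contradiction (injective (trans p (sym q))) λ ()
  disjoint-edges (inj₂ p) (inj₂ q) = contradiction (injective (trans p (sym q))) λ ()

view-inject₁ : ∀ {n} (x : Fin n) → view (inject₁ x) ≡ just x
view-inject₁ {suc n} zero    = refl
view-inject₁ {suc n} (suc x) rewrite view-inject₁ x = refl

view-fromℕ : ∀ n → view (fromℕ n) ≡ nothing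
view-fromℕ zero    = refl
view-fromℕ (suc n) rewrite view-fromℕ n = refl

module _ {n} (G : Adj n) (v : Fin n) (A B : Fin n → Bool) where

  split-v₁ : ∀ y → split G v A B (inject₁ v) (inject₁ y) ≡ A y
  split-v₁ y rewrite view-inject₁ v | view-inject₁ y | dec-true (v ≟ v) refl = refl

  split-v₂ : ∀ y → split G v A B (fromℕ n) (inject₁ y) ≡ B y
  split-v₂ y rewrite view-fromℕ n | view-inject₁ y = refl

  split-unchanged : ∀ {x y} → x ≢ v → y ≢ v → split G v A B (inject₁ x) (inject₁ y) ≡ G x y
  split-unchanged {x} {y} x≢v y≢v
    rewrite view-inject₁ x | view-inject₁ y | dec-false (x ≟ v) x≢v | dec-false (y ≟ v) y≢v = refl

  split-isGraph : IsGraph G → IsSplitData G v A B → IsGraph (split G v A B)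
  split-isGraph graph splitData = record { symmetric = symmetric′ ; irreflexive = irreflexive′ }
    where
    open IsGraph graph

    symmetric′ : ∀ x y → split G v A B x y ≡ split G v A B y x
    symmetric′ x y with view x | view y
    ... | nothing | nothing = refl
    ... | nothing | just _  = refl
    ... | just _  | nothing = refl
    ... | just x′ | just y′ with x′ ≟ v | y′ ≟ v
    ... | yes refl | yes refl = refl
    ... | yes refl | no _     = refl
    ... | no _     | yes refl = refl
    ... | no _     | no _     = symmetric x′ y′

    irreflexive′ : ∀ x → split G v A B x x ≡ false
    irreflexive′ x with view x
    ... | nothing = refl
    ... | just x′ with x′ ≟ v
    ... | yes refl = ∨-conicalˡ (A v) (B v) (trans (splitData v) (irreflexive v))
    ... | no _     = irreflexive x′

  split-nonadjacent : ∀ {ys} → All (_≢ v) ys → AllPairs (λ x y → G x y ≡ false) ys →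
                      AllPairs (λ x y → split G v A B x y ≡ false) (map inject₁ ys)
  split-nonadjacent []              []                    = []
  split-nonadjacent (x≢v ∷ ys≢v) (x≁ys ∷ ys-nonadjacent) =
    All.map⁺ (All.zipWith (λ (y≢v , x≁y) → trans (split-unchanged x≢v y≢v) x≁y) (ys≢v , x≁ys))
    ∷ split-nonadjacent ys≢v ys-nonadjacent

splitSeq-isGraph : ∀ {n m k} {G : Adj n} {H : Adj m} → SplitSeq G H k → IsGraph G → IsGraph H
splitSeq-isGraph done                         graph = graph
splitSeq-isGraph (step v A B splitData splits) graph =
  splitSeq-isGraph splits (split-isGraph _ v A B graph splitData)

record InducedK2 {n : ℕ} (G : Adj n) (t : ℕ) : Set where
  field
    hub₁ hub₂          : Fin n
    hubs-distinct      : hub₁ ≢ hub₂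
    hubs-nonadjacent   : G hub₁ hub₂ ≡ false
    leaves             : List (Fin n)
    leaves-distinct    : Unique leaves
    leaves-nonadjacent : AllPairs (λ x y → G x y ≡ false) leaves
    leaves-adjacent    : All (λ x → G hub₁ x ≡ true × G hub₂ x ≡ true) leaves
    enough-leaves      : t ≤ length leaves

module _ {n} {G : Adj n} where

  InducedK2-weaken : ∀ {s t} → t ≤ s → InducedK2 G s → InducedK2 G t
  InducedK2-weaken t≤s K = record
    { InducedK2 K hiding (enough-leaves) ; enough-leaves = ≤-trans t≤s (InducedK2.enough-leaves K) }

  InducedK2-swap : ∀ {t} → IsGraph G → InducedK2 G t → InducedK2 G t
  InducedK2-swap graph K = record K
    { hub₁             = hub₂
    ; hub₂             = hub₁
    ; hubs-distinct    = ≢-sym hubs-distinct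
    ; hubs-nonadjacent = trans (IsGraph.symmetric graph hub₂ hub₁) hubs-nonadjacent
    ; leaves-adjacent  = All.map swap leaves-adjacent
    }
    where open InducedK2 K

  InducedK2⇒InducedCycle : IsGraph G → (K : InducedK2 G 2) → let open InducedK2 K in
                           {keep : Fin n → Set} → keep hub₁ → keep hub₂ → All keep leaves →
                           InducedCycleIn G keep 0
  InducedK2⇒InducedCycle graph
    record { hub₁ = a ; hub₂ = b ; hubs-distinct = a≢b ; hubs-nonadjacent = a≁b
           ; leaves = x ∷ y ∷ _ ; leaves-distinct = (x≢y ∷ _) ∷ _
           ; leaves-nonadjacent = (x≁y ∷ _) ∷ _
           ; leaves-adjacent = (a~x , b~x) ∷ (a~y , b~y) ∷ _ }
    ka kb (kx ∷ ky ∷ _) =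
    commonNeighbours⇒InducedCycle graph a≢b x≢y a≁b x≁y a~x b~x a~y b~y ka kx kb ky
  InducedK2⇒InducedCycle _ record { leaves = []     ; enough-leaves = () } _ _ _
  InducedK2⇒InducedCycle _ record { leaves = _ ∷ [] ; enough-leaves = s≤s () } _ _ _

  InducedK2⇒¬Chordal : IsGraph G → InducedK2 G 2 → ¬ Chordal G
  InducedK2⇒¬Chordal graph K chordal =
    chordal 0 (InducedK2⇒InducedCycle graph K hub₁ hub₂ (All.universal (λ x → x) leaves))
    where open InducedK2 K

module _ {n} {G : Adj n} {v : Fin n} {A B : Fin n → Bool}
         (graph : IsGraph G) (splitData : IsSplitData G v A B) where

  retainHub₂ : ∀ {t c} (K : InducedK2 G t) → let open InducedK2 K in
               hub₂ ≢ v → (h : Fin (suc n)) → h ≢ inject₁ hub₂ →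
               split G v A B h (inject₁ hub₂) ≡ false →
               {S : Pred (Fin n) 0ℓ} (S? : Decidable S) →
               (∀ {x} → S x → G hub₁ x ≡ true → x ≢ v × split G v A B h (inject₁ x) ≡ true) →
               c ≤ length (filter S? leaves) → InducedK2 (split G v A B) c
  retainHub₂ {c = c} K hub₂≢v h h≢hub₂ h≁hub₂ S? survives enough = record
    { hub₁               = h
    ; hub₂               = inject₁ hub₂
    ; hubs-distinct      = h≢hub₂
    ; hubs-nonadjacent   = h≁hub₂
    ; leaves             = map inject₁ kept
    ; leaves-distinct    = Unique.map⁺ inject₁-injective (Unique.filter⁺ S? leaves-distinct)
    ; leaves-nonadjacent =
        split-nonadjacent G v A B (All.map proj₁ kept-survive)
                                  (AllPairs.filter⁺ S? leaves-nonadjacent)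
    ; leaves-adjacent    =
        All.map⁺ (All.zipWith
          (λ ((x≢v , h~x) , (_ , b~x)) → h~x , trans (split-unchanged G v A B hub₂≢v x≢v) b~x)
          (kept-survive , All.filter⁺ S? leaves-adjacent))
    ; enough-leaves      = subst (c ≤_) (sym (length-map inject₁ kept)) enough
    }
    where
    open InducedK2 K
    kept : List (Fin n)
    kept = filter S? leaves
    kept-survive : All (λ x → x ≢ v × split G v A B h (inject₁ x) ≡ true) kept
    kept-survive = All.zipWith (λ (Sx , (a~x , _)) → survives Sx a~x)
                               (All.all-filter S? leaves , All.filter⁺ S? leaves-adjacent)

  split-hub₁-InducedK2 : ∀ {c} (K : InducedK2 G (2 * c)) → v ≡ InducedK2.hub₁ K →
                         InducedK2 (split G v A B) c
  split-hub₁-InducedK2 {c} K refl = [ keepA , keepB ]′ (2*c≤m+n⇒c≤m⊎c≤n c _ _ leaves-shared)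
    where
    open InducedK2 K

    A? : Decidable (λ x → A x ≡ true)
    A? x = A x Bool.≟ true

    leaves-shared : 2 * c ≤ length (filter A? leaves) + length (filter (∁? A?) leaves)
    leaves-shared = subst (2 * c ≤_) (sym (length-filter-∁ A? leaves)) enough-leaves

    hub₂≢hub₁ : hub₂ ≢ hub₁
    hub₂≢hub₁ = ≢-sym hubs-distinct

    A∨B-hub₂ : A hub₂ ∨ B hub₂ ≡ false
    A∨B-hub₂ = trans (splitData hub₂) hubs-nonadjacent

    keepA : c ≤ length (filter A? leaves) → InducedK2 (split G v A B) c
    keepA = retainHub₂ K hub₂≢hub₁ (inject₁ hub₁) (hubs-distinct ∘ inject₁-injective)
              (trans (split-v₁ G v A B hub₂) (∨-conicalˡ _ _ A∨B-hub₂)) A?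
              (λ {x} Ax a~x → ≢-sym (adjacent⇒≢ graph a~x) , trans (split-v₁ G v A B x) Ax)

    -- every leaf x is adjacent to v, so A x ∨ B x holds: the leaves v₁ misses are seen by v₂
    keepB : c ≤ length (filter (∁? A?) leaves) → InducedK2 (split G v A B) c
    keepB = retainHub₂ K hub₂≢hub₁ (fromℕ n) fromℕ≢inject₁
              (trans (split-v₂ G v A B hub₂) (∨-conicalʳ _ _ A∨B-hub₂)) (∁? A?)
              (λ {x} ¬Ax a~x → ≢-sym (adjacent⇒≢ graph a~x) ,
                 trans (split-v₂ G v A B x)
                       (subst (λ α → α ∨ B x ≡ true) (¬-not ¬Ax) (trans (splitData x) a~x)))

  split-other-InducedK2 : ∀ {c} (K : InducedK2 G (2 * c)) →
                          v ≢ InducedK2.hub₁ K → v ≢ InducedK2.hub₂ K → InducedK2 (split G v A B) c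
  split-other-InducedK2 {c} K v≢a v≢b =
    retainHub₂ K (≢-sym v≢b) (inject₁ hub₁) (hubs-distinct ∘ inject₁-injective)
      (trans (split-unchanged G v A B (≢-sym v≢a) (≢-sym v≢b)) hubs-nonadjacent) (∁? (_≟ v))
      (λ {x} x≢v a~x → x≢v , trans (split-unchanged G v A B (≢-sym v≢a) x≢v) a~x)
      (2*c≤1+m⇒c≤m c (≤-trans enough-leaves (length≤1+length-filter-≢ _≟_ v leaves-distinct)))
    where open InducedK2 K

  split-InducedK2 : ∀ {c} → InducedK2 G (2 * c) → InducedK2 (split G v A B) c
  split-InducedK2 K with v ≟ InducedK2.hub₁ K | v ≟ InducedK2.hub₂ K
  ... | yes v≡a | _       = split-hub₁-InducedK2 K v≡a
  ... | no _    | yes v≡b = split-hub₁-InducedK2 (InducedK2-swap graph K) v≡b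
  ... | no v≢a  | no v≢b  = split-other-InducedK2 K v≢a v≢b

splitSeq-InducedK2 : ∀ {n m k c} {G : Adj n} {H : Adj m} → SplitSeq G H k → IsGraph G →
                     InducedK2 G (2 ^ k * c) → InducedK2 H c
splitSeq-InducedK2 {c = c} done _ K = subst (InducedK2 _) (*-identityˡ c) K
splitSeq-InducedK2 {k = suc k} {c} (step v A B splitData splits) graph K =
  splitSeq-InducedK2 splits (split-isGraph _ v A B graph splitData)
    (split-InducedK2 graph splitData (subst (InducedK2 _) (*-assoc 2 (2 ^ k) c) K))

isHub : ∀ {s} → Fin (2 + s) → Bool
isHub zero          = true
isHub (suc zero)    = true
isHub (suc (suc _)) = false

K2 : (s : ℕ) → Adj (2 + s)
K2 s x y = isHub x xor isHub y

K2-isGraph : ∀ {s} → IsGraph (K2 s)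
K2-isGraph = record
  { symmetric   = λ x y → xor-comm (isHub x) (isHub y)
  ; irreflexive = λ x → xor-same (isHub x)
  }

K2-InducedK2 : ∀ s → InducedK2 (K2 s) s
K2-InducedK2 s = record
  { hub₁               = zero
  ; hub₂               = suc zero
  ; hubs-distinct      = λ ()
  ; hubs-nonadjacent   = refl
  ; leaves             = tabulate (2 ↑ʳ_)
  ; leaves-distinct    = Unique.tabulate⁺ (↑ʳ-injective 2 _ _)
  ; leaves-nonadjacent = AllPairs.tabulate⁺ (const refl)
  ; leaves-adjacent    = All.tabulate⁺ (const (refl , refl))
  ; enough-leaves      = ≤-reflexive (sym (length-tabulate (2 ↑ʳ_)))
  }

K2-centred-at-hub₂ : ∀ {s} {x y : Fin (2 + s)} → x ∉ ⁅ zero ⁆ → y ∉ ⁅ zero ⁆ → K2 s x y ≡ true →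
                     x ≡ suc zero ⊎ y ≡ suc zero
K2-centred-at-hub₂ {x = zero}                      0∉ _  _  = contradiction (x∈⁅x⁆ zero) 0∉
K2-centred-at-hub₂ {x = suc zero}                  _  _  _  = inj₁ refl
K2-centred-at-hub₂ {x = suc (suc _)} {zero}        _  0∉ _  = contradiction (x∈⁅x⁆ zero) 0∉
K2-centred-at-hub₂ {x = suc (suc _)} {suc zero}    _  _  _  = inj₂ refl
K2-centred-at-hub₂ {x = suc (suc _)} {suc (suc _)} _  _  ()

∣p∣≡0⇒x∉p : ∀ {n} {p : Subset n} → ∣ p ∣ ≡ 0 → ∀ x → x ∉ p
∣p∣≡0⇒x∉p {p = p} ∣p∣≡0 x x∈p = n≮0 (subst (∣ p - x ∣ <_) ∣p∣≡0 (x∈p⇒∣p-x∣<∣p∣ x∈p))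

K2-ChVD : ∀ r → IsChVD (K2 (2 + r)) 1
K2-ChVD r =
  (⁅ zero ⁆ , centred⇒ChordalOn (suc zero) K2-centred-at-hub₂ , ∣⁅x⁆∣≡1 {4 + r} zero) , nonempty
  where
  nonempty : ∀ D → ChordalDeletion (K2 (2 + r)) D → 1 ≤ ∣ D ∣
  nonempty D chordal = n≢0⇒n>0 (chordal 0 ∘ cycle-avoiding)
    where
    cycle-avoiding : ∣ D ∣ ≡ 0 → InducedCycleIn (K2 (2 + r)) (_∉ D) 0
    cycle-avoiding ∣D∣≡0 =
      InducedK2⇒InducedCycle K2-isGraph (InducedK2-weaken (m≤m+n 2 r) (K2-InducedK2 (2 + r)))
        (∣p∣≡0⇒x∉p ∣D∣≡0 zero) (∣p∣≡0⇒x∉p ∣D∣≡0 (suc zero))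
        (All.universal (∣p∣≡0⇒x∉p ∣D∣≡0) (tabulate (2 ↑ʳ_)))

theorem5 : (f : ℕ → ℕ) →
    ¬ (∀ (n : ℕ) (G : Adj n) → IsGraph G → (k : ℕ) → IsChVD G k → ChVS≤ G (f k))
theorem5 f bounded with bounded _ (K2 (2 + 2 ^ f 1 * 2)) K2-isGraph 1 (K2-ChVD _)
... | _ , _ , k , splits , chordal , k≤f1 =
  InducedK2⇒¬Chordal (splitSeq-isGraph splits K2-isGraph)
    (splitSeq-InducedK2 splits K2-isGraph (InducedK2-weaken enough (K2-InducedK2 _))) chordal
  where
  enough : 2 ^ k * 2 ≤ 2 + 2 ^ f 1 * 2
  enough = ≤-trans (*-monoˡ-≤ 2 (^-monoʳ-≤ 2 k≤f1)) (m≤n+m _ 2)
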